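{- Let $\sigma^1, \ldots, \sigma^K$ be permutations and for each $q \in [1..K]$ let $[i_q..j_q]$ and $[a_q..b_q]$ be intervals. Let $\pi$ be a separable permutation which has, for every $q$, an occurrence in $\sigma^q$ using the interval $[i_q..j_q]$ of indices and $[a_q..b_q]$ of values, and which is of maximal length among all separable permutations with this property. If $\pi = \pi_1 \oplus \pi_2$ (resp. $\pi = \pi_1 \ominus \pi_2$) with $\pi_1, \pi_2$ non-empty separable permutations, then there exist integers $h_q, c_q$ with $i_q < h_q \le j_q$ and $a_q < c_q \le b_q$ for all $q \in [1..K]$ such that: (i) $\pi_1$ is of maximal length among separable permutations having, for every $q$, an occurrence in $\sigma^q$ using the interval $[i_q..h_q-1]$ of indices and $[a_q..c_q-1]$ (resp. $[c_q..b_q]$) of values, and $\pi_1$ itself has such occurrences; and (ii) $\pi_2$ is of maximal length among separable permutations having, for every $q$, an occurrence in $\sigma^q$ using the interval $[h_q..j_q]$ of indices and $[c_q..b_q]$ (resp. $[a_q..c_q-1]$) of values, and $\pi_2$ itself has such occurrences.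
   Context: A permutation of length $n$ is a bijection of $[1..n]$, written $\sigma_1\cdots\sigma_n$; $\sigma_i$ is the value at index $i$. A permutation $\pi$ of length $k$ has an occurrence $\sigma_{i_1}\cdots\sigma_{i_k}$ ($i_1<\cdots<i_k$) in $\sigma$ if $\sigma_{i_\ell} < \sigma_{i_m}$ whenever $\pi_\ell < \pi_m$; the occurrence uses the interval $I$ of indices and $V$ of values if $\{i_1,\ldots,i_k\} \subseteq I$ and $\{\sigma_{i_1},\ldots,\sigma_{i_k}\} \subseteq V$. A permutation is separable if it involves neither $2413$ nor $3142$ as a pattern. For $\pi$ of length $k$ and $\pi'$ of length $k'$: $\pi \oplus \pi' = \pi_1\cdots\pi_k(\pi'_1+k)\cdots(\pi'_{k'}+k)$ and $\pi \ominus \pi' = (\pi_1+k')\cdots(\pi_k+k')\pi'_1\cdots\pi'_{k'}$. -}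

module Defs where

open import Data.Nat using (ℕ; zero; suc; _+_; _≤_)
open import Data.Integer using (ℤ; +_; _-_; _<_) renaming (_≤_ to _≤ℤ_)
open import Data.Fin using (Fin; toℕ; splitAt) renaming (_<_ to _<ᶠ_)
open import Data.Sum using ([_,_])
open import Data.Product using (_×_; Σ)
open import Relation.Binary.PropositionalEquality using (_≡_)
open import Function.Definitions using (Injective)
open import Relation.Nullary using (¬_)

-- A permutation of length n: an injective (hence bijective) map Fin n → Fin n.
-- Index position x : Fin n is index toℕ x + 1, value y : Fin n is value toℕ y + 1.
record Perm (n : ℕ) : Set where
  field
    fun : Fin n → Fin n
    inj : Injective _≡_ _≡_ fun
open Perm public

pos : ∀ {n} → Fin n → ℤ
pos x = + suc (toℕ x)

record Box : Set where
  constructor box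
  field
    lo-i hi-i lo-v hi-v : ℤ
open Box public

-- An occurrence of a pattern p (length k) in s (length n):
-- strictly increasing index map f with  p l < p m  ⇒  s (f l) < s (f m).
-- (Patterns are given as raw maps so that 2413 / 3142 can be written directly.)
OccursIn : ∀ {k n} → (Fin k → Fin k) → (Fin n → Fin n) → Set
OccursIn {k} {n} p s =
  Σ (Fin k → Fin n) λ f →
    (∀ l m → l <ᶠ m → f l <ᶠ f m) ×
    (∀ l m → p l <ᶠ p m → s (f l) <ᶠ s (f m))

OccursInBox : ∀ {k n} → (Fin k → Fin k) → (Fin n → Fin n) → Box → Set
OccursInBox {k} {n} p s (box i j a b) =
  Σ (Fin k → Fin n) λ f →
    (∀ l m → l <ᶠ m → f l <ᶠ f m) ×
    (∀ l m → p l <ᶠ p m → s (f l) <ᶠ s (f m)) ×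
    (∀ l → (i ≤ℤ pos (f l)) × (pos (f l) ≤ℤ j) ×
           (a ≤ℤ pos (s (f l))) × (pos (s (f l)) ≤ℤ b))

-- the patterns 2413 and 3142 (0-based values)
p2413 : Fin 4 → Fin 4
p2413 Fin.zero = Fin.suc Fin.zero
p2413 (Fin.suc Fin.zero) = Fin.suc (Fin.suc (Fin.suc Fin.zero))
p2413 (Fin.suc (Fin.suc Fin.zero)) = Fin.zero
p2413 (Fin.suc (Fin.suc (Fin.suc _))) = Fin.suc (Fin.suc Fin.zero)

p3142 : Fin 4 → Fin 4
p3142 Fin.zero = Fin.suc (Fin.suc Fin.zero)
p3142 (Fin.suc Fin.zero) = Fin.zero
p3142 (Fin.suc (Fin.suc Fin.zero)) = Fin.suc (Fin.suc (Fin.suc Fin.zero))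
p3142 (Fin.suc (Fin.suc (Fin.suc _))) = Fin.suc Fin.zero

Separable : ∀ {n} → Perm n → Set
Separable σ = ¬ OccursIn p2413 (fun σ) × ¬ OccursIn p3142 (fun σ)

OccursInAll : ∀ {K k} {n : Fin K → ℕ} → Perm k →
              ((q : Fin K) → Perm (n q)) → (Fin K → Box) → Set
OccursInAll {K} ρ σ B = (q : Fin K) → OccursInBox (fun ρ) (fun (σ q)) (B q)

MaximalSep : ∀ {K k} {n : Fin K → ℕ} → Perm k →
             ((q : Fin K) → Perm (n q)) → (Fin K → Box) → Set
MaximalSep {K} {k} π σ B =
  Separable π × OccursInAll π σ B ×
  (∀ m (ρ : Perm m) → Separable ρ → OccursInAll ρ σ B → m ≤ k)

⊕ᵛ : ∀ {k₁ k₂} → Perm k₁ → Perm k₂ → Fin (k₁ + k₂) → ℕ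
⊕ᵛ {k₁} {k₂} π₁ π₂ x =
  [ (λ y → toℕ (fun π₁ y)) , (λ z → k₁ + toℕ (fun π₂ z)) ] (splitAt k₁ x)

⊖ᵛ : ∀ {k₁ k₂} → Perm k₁ → Perm k₂ → Fin (k₁ + k₂) → ℕ
⊖ᵛ {k₁} {k₂} π₁ π₂ x =
  [ (λ y → k₂ + toℕ (fun π₁ y)) , (λ z → toℕ (fun π₂ z)) ] (splitAt k₁ x)

IsDirectSum : ∀ {k₁ k₂} → Perm (k₁ + k₂) → Perm k₁ → Perm k₂ → Set
IsDirectSum π π₁ π₂ = ∀ x → toℕ (fun π x) ≡ ⊕ᵛ π₁ π₂ x

IsSkewSum : ∀ {k₁ k₂} → Perm (k₁ + k₂) → Perm k₁ → Perm k₂ → Set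
IsSkewSum π π₁ π₂ = ∀ x → toℕ (fun π x) ≡ ⊖ᵛ π₁ π₂ x

SplitOK : ∀ {K} → (Fin K → Box) → (Fin K → ℤ) → (Fin K → ℤ) → Set
SplitOK {K} B h c = (q : Fin K) →
  (lo-i (B q) < h q) × (h q ≤ℤ hi-i (B q)) ×
  (lo-v (B q) < c q) × (c q ≤ℤ hi-v (B q))

-- An occurrence of π = π₁ ⊕ π₂ (or π₁ ⊖ π₂) in a box is cut at the index h of the first
-- entry of its π₂-part and at the value c of the lowest entry of its upper summand: the
-- two parts then lie in opposite quadrants of the box at (h, c). Conversely, occurrences
-- of any ρ₁, ρ₂ in these quadrants glue to an occurrence of their sum. Sums of separable
-- permutations are separable: the inversion graph (for ⊕) and the non-inversion graph
-- (for ⊖) of 2413 and of 3142 are connected, so every occurrence of these patterns in a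
-- sum lies inside one summand. Hence a longer separable ρ in one quadrant would give a
-- longer separable ρ ⊕ π₂ (resp. π₁ ⊕ ρ, ...) in the whole box, against the maximality of π.
module Submission where

open import Defs
open import Data.Nat using (ℕ; _+_; _≥_)
open import Data.Integer using (ℤ; _-_; 1ℤ)
open import Data.Fin using (Fin)
open import Data.Product using (_×_; Σ)

open import Data.Bool.Base using (Bool; true; false)
import Data.Bool.Properties as Boolₚ
open import Data.Empty using (⊥-elim)
open import Data.Fin using (#_)
open import Data.Fin.Base using (zero; suc; toℕ; splitAt; fromℕ<; punchOut; _↑ˡ_; _↑ʳ_; _<_; _≤_; _>_)
import Data.Fin.Properties as Finₚ
open import Data.Integer.Base using (-1ℤ; +≤+; +<+) renaming (_≤_ to _≤ℤ_; _<_ to _<ℤ_)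
import Data.Integer.Properties as ℤₚ
import Data.Nat.Base as ℕ
open import Data.Nat.Base using (suc; z≤n; s≤s; z<s; s<s)
import Data.Nat.Properties as ℕₚ
open import Data.Product using (_,_; proj₁; proj₂; ∃; uncurry)
open import Data.Sum.Base using (_⊎_; inj₁; inj₂; [_,_]′)
open import Data.Vec.Functional using (_++_)
open import Data.Vec.Functional.Properties using (lookup-++ˡ; lookup-++ʳ)
open import Data.Vec.Functional.Relation.Unary.All.Properties using (++⁺)
open import Function.Base using (_∘_)
open import Function.Definitions using (Injective)
open import Relation.Binary.PropositionalEquality using (_≡_; _≢_; refl; sym; trans; cong; subst; subst₂)
open import Relation.Nullary using (¬_; yes; no; contradiction)

pos-mono-≤ : ∀ {m n} {x : Fin m} {y : Fin n} → x ≤ y → pos x ≤ℤ pos y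
pos-mono-≤ x≤y = +≤+ (s≤s x≤y)

-- pos y - 1ℤ computes to + toℕ y.
pos-<⇒≤-1 : ∀ {m n} {x : Fin m} {y : Fin n} → x < y → pos x ≤ℤ pos y - 1ℤ
pos-<⇒≤-1 x<y = +≤+ x<y

pos-separated : ∀ {m n} {x : Fin m} {y : Fin n} {u v : ℤ} →
                pos x ≤ℤ u → u <ℤ v → v ≤ℤ pos y → x < y
pos-separated x≤u u<v v≤y with ℤₚ.≤-<-trans x≤u (ℤₚ.<-≤-trans u<v v≤y)
... | +<+ sx<sy = ℕ.s<s⁻¹ sx<sy

i-1<i : ∀ i → i - 1ℤ <ℤ i
i-1<i i = ℤₚ.i≤pred[j]⇒i<j (ℤₚ.≤-reflexive (ℤₚ.+-comm i -1ℤ))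

≤-1⇒< : ∀ {i j} → i ≤ℤ j - 1ℤ → i <ℤ j
≤-1⇒< {j = j} i≤j-1 = ℤₚ.≤-<-trans i≤j-1 (i-1<i j)

StrictlyMonotone : ∀ {k n} → (Fin k → Fin n) → Set
StrictlyMonotone f = ∀ l m → l < m → f l < f m

<-mono⇒≤-mono : ∀ {k n} {φ : Fin k → Fin k} {g : Fin k → Fin n} → Injective _≡_ _≡_ φ →
                (∀ x y → φ x < φ y → g x < g y) → ∀ x y → φ x ≤ φ y → g x ≤ g y
<-mono⇒≤-mono φ-inj g-mono x y φx≤φy with ℕₚ.m≤n⇒m<n∨m≡n φx≤φy
... | inj₁ φx<φy = ℕₚ.<⇒≤ (g-mono x y φx<φy)
... | inj₂ φx≡φy with φ-inj (Finₚ.toℕ-injective φx≡φy)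
...   | refl = ℕₚ.≤-refl

Perm-surjective : ∀ {n} (π : Perm n) (y : Fin n) → ∃ λ x → fun π x ≡ y
Perm-surjective {suc n} π y with Finₚ.any? (λ x → fun π x Finₚ.≟ y)
... | yes hit = hit
... | no miss = contradiction (Finₚ.injective⇒≤ punched-injective) ℕₚ.1+n≰n
  where
  punched : Fin (suc n) → Fin n
  punched x = punchOut {i = y} {j = fun π x} (λ y≡πx → miss (x , sym y≡πx))
  punched-injective : Injective _≡_ _≡_ punched
  punched-injective eq = inj π (Finₚ.punchOut-injective {i = y} _ _ eq)

module _ {m₁ m₂ : ℕ} where

  ↑ˡ-mono-< : StrictlyMonotone {m₁} (_↑ˡ m₂)
  ↑ˡ-mono-< y y' = subst₂ ℕ._<_ (sym (Finₚ.toℕ-↑ˡ y m₂)) (sym (Finₚ.toℕ-↑ˡ y' m₂))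

  ↑ˡ-cancel-< : ∀ {y y' : Fin m₁} → y ↑ˡ m₂ < y' ↑ˡ m₂ → y < y'
  ↑ˡ-cancel-< {y} {y'} = subst₂ ℕ._<_ (Finₚ.toℕ-↑ˡ y m₂) (Finₚ.toℕ-↑ˡ y' m₂)

  ↑ʳ-mono-< : StrictlyMonotone {m₂} (m₁ ↑ʳ_)
  ↑ʳ-mono-< z z' = subst₂ ℕ._<_ (sym (Finₚ.toℕ-↑ʳ m₁ z)) (sym (Finₚ.toℕ-↑ʳ m₁ z')) ∘ ℕₚ.+-monoʳ-< m₁

  ↑ʳ-mono-≤ : ∀ {z z' : Fin m₂} → z ≤ z' → m₁ ↑ʳ z ≤ m₁ ↑ʳ z'
  ↑ʳ-mono-≤ {z} {z'} = subst₂ ℕ._≤_ (sym (Finₚ.toℕ-↑ʳ m₁ z)) (sym (Finₚ.toℕ-↑ʳ m₁ z')) ∘ ℕₚ.+-monoʳ-≤ m₁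

  ↑ʳ-cancel-< : ∀ {z z' : Fin m₂} → m₁ ↑ʳ z < m₁ ↑ʳ z' → z < z'
  ↑ʳ-cancel-< {z} {z'} = ℕₚ.+-cancelˡ-< m₁ _ _ ∘ subst₂ ℕ._<_ (Finₚ.toℕ-↑ʳ m₁ z) (Finₚ.toℕ-↑ʳ m₁ z')

  ↑ˡ<↑ʳ : ∀ (y : Fin m₁) (z : Fin m₂) → y ↑ˡ m₂ < m₁ ↑ʳ z
  ↑ˡ<↑ʳ y z = subst₂ ℕ._<_ (sym (Finₚ.toℕ-↑ˡ y m₂)) (sym (Finₚ.toℕ-↑ʳ m₁ z))
                (ℕₚ.<-≤-trans (Finₚ.toℕ<n y) (ℕₚ.m≤m+n m₁ (toℕ z)))

data Block (m₁ m₂ : ℕ) : Fin (m₁ + m₂) → Set where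
  left  : (y : Fin m₁) → Block m₁ m₂ (y ↑ˡ m₂)
  right : (z : Fin m₂) → Block m₁ m₂ (m₁ ↑ʳ z)

block : ∀ m₁ {m₂} (x : Fin (m₁ + m₂)) → Block m₁ m₂ x
block m₁ x with splitAt m₁ x in eq
... | inj₁ y = subst (Block m₁ _) (Finₚ.splitAt⁻¹-↑ˡ eq) (left y)
... | inj₂ z = subst (Block m₁ _) (Finₚ.splitAt⁻¹-↑ʳ eq) (right z)

isLeft : ∀ {m₁ m₂ x} → Block m₁ m₂ x → Bool
isLeft (left _)  = true
isLeft (right _) = false

module _ {m₁ m₂ : ℕ} where

  left-part : ∀ {x} (b : Block m₁ m₂ x) → isLeft b ≡ true → ∃ λ y → y ↑ˡ m₂ ≡ x
  left-part (left y) _ = y , refl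

  right-part : ∀ {x} (b : Block m₁ m₂ x) → isLeft b ≡ false → ∃ λ z → m₁ ↑ʳ z ≡ x
  right-part (right z) _ = z , refl

  by-blocks : {P : Fin (m₁ + m₂) → Fin (m₁ + m₂) → Set} →
              (∀ y y' → P (y ↑ˡ m₂) (y' ↑ˡ m₂)) → (∀ y z → P (y ↑ˡ m₂) (m₁ ↑ʳ z)) →
              (∀ z y → P (m₁ ↑ʳ z) (y ↑ˡ m₂)) → (∀ z z' → P (m₁ ↑ʳ z) (m₁ ↑ʳ z')) →
              ∀ x x' → P x x'
  by-blocks ll lr rl rr x x' with block m₁ x | block m₁ x'
  ... | left y  | left y'  = ll y y'
  ... | left y  | right z  = lr y z
  ... | right z | left y   = rl z y
  ... | right z | right z' = rr z z'

  ++-pairwise : ∀ {A : Set} {f : Fin m₁ → A} {g : Fin m₂ → A}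
                {R : Fin (m₁ + m₂) → Fin (m₁ + m₂) → Set} {S : A → A → Set} →
                (∀ y y' → R (y ↑ˡ m₂) (y' ↑ˡ m₂) → S (f y) (f y')) →
                (∀ y z → R (y ↑ˡ m₂) (m₁ ↑ʳ z) → S (f y) (g z)) →
                (∀ z y → R (m₁ ↑ʳ z) (y ↑ˡ m₂) → S (g z) (f y)) →
                (∀ z z' → R (m₁ ↑ʳ z) (m₁ ↑ʳ z') → S (g z) (g z')) →
                ∀ x x' → R x x' → S ((f ++ g) x) ((f ++ g) x')
  ++-pairwise {f = f} {g} {S = S} ll lr rl rr = by-blocks
    (λ y y' → subst₂ S (sym (lookup-++ˡ f g y)) (sym (lookup-++ˡ f g y')) ∘ ll y y')
    (λ y z  → subst₂ S (sym (lookup-++ˡ f g y)) (sym (lookup-++ʳ f g z)) ∘ lr y z)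
    (λ z y  → subst₂ S (sym (lookup-++ʳ f g z)) (sym (lookup-++ˡ f g y)) ∘ rl z y)
    (λ z z' → subst₂ S (sym (lookup-++ʳ f g z)) (sym (lookup-++ʳ f g z')) ∘ rr z z')

  ++-injective : {f : Fin m₁ → ℕ} {g : Fin m₂ → ℕ} →
                 Injective _≡_ _≡_ f → Injective _≡_ _≡_ g → (∀ y z → f y ≢ g z) →
                 Injective _≡_ _≡_ (f ++ g)
  ++-injective {f} {g} f-inj g-inj f≢g {x} {x'} = by-blocks
    {P = λ x x' → (f ++ g) x ≡ (f ++ g) x' → x ≡ x'}
    (λ y y' → cong (_↑ˡ m₂) ∘ f-inj ∘ subst₂ _≡_ (lookup-++ˡ f g y) (lookup-++ˡ f g y'))
    (λ y z  → ⊥-elim ∘ f≢g y z ∘ subst₂ _≡_ (lookup-++ˡ f g y) (lookup-++ʳ f g z))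
    (λ z y  → ⊥-elim ∘ f≢g y z ∘ sym ∘ subst₂ _≡_ (lookup-++ʳ f g z) (lookup-++ˡ f g y))
    (λ z z' → cong (m₁ ↑ʳ_) ∘ g-inj ∘ subst₂ _≡_ (lookup-++ʳ f g z) (lookup-++ʳ f g z'))
    x x'

record Shifted {m n} (τ : Fin n → Fin n) (e : Fin m → Fin n) (o : ℕ) (ρ : Fin m → Fin m) : Set where
  constructor shifted
  field shift : ∀ y → toℕ (τ (e y)) ≡ o + toℕ (ρ y)
open Shifted

module _ {m n} {τ : Fin n → Fin n} {e : Fin m → Fin n} {o : ℕ} {ρ : Fin m → Fin m}
         (sh : Shifted τ e o ρ) where

  shifted-mono-< : ∀ {y y'} → ρ y < ρ y' → τ (e y) < τ (e y')
  shifted-mono-< {y} {y'} = subst₂ ℕ._<_ (sym (shift sh y)) (sym (shift sh y')) ∘ ℕₚ.+-monoʳ-< o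

  shifted-mono-≤ : ∀ {y y'} → ρ y ≤ ρ y' → τ (e y) ≤ τ (e y')
  shifted-mono-≤ {y} {y'} = subst₂ ℕ._≤_ (sym (shift sh y)) (sym (shift sh y')) ∘ ℕₚ.+-monoʳ-≤ o

  shifted-cancel-< : ∀ {y y'} → τ (e y) < τ (e y') → ρ y < ρ y'
  shifted-cancel-< {y} {y'} = ℕₚ.+-cancelˡ-< o _ _ ∘ subst₂ ℕ._<_ (shift sh y) (shift sh y')

lower<upper : ∀ {m m' n} {τ : Fin n → Fin n} {e : Fin m → Fin n} {e' : Fin m' → Fin n}
              {ρ : Fin m → Fin m} {ρ' : Fin m' → Fin m'} →
              Shifted τ e 0 ρ → Shifted τ e' m ρ' → ∀ y z → τ (e y) < τ (e' z)
lower<upper {m} {ρ = ρ} {ρ'} sh sh' y z = subst₂ ℕ._<_ (sym (shift sh y)) (sym (shift sh' z))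
  (ℕₚ.<-≤-trans (Finₚ.toℕ<n (ρ y)) (ℕₚ.m≤m+n m (toℕ (ρ' z))))

fromValues : ∀ {n} (v : Fin n → ℕ) → (∀ x → v x ℕ.< n) → Injective _≡_ _≡_ v → Perm n
fromValues v v<n v-inj = record
  { fun = λ x → fromℕ< (v<n x)
  ; inj = λ {x} {x'} eq → v-inj (trans (sym (Finₚ.toℕ-fromℕ< (v<n x)))
                                  (trans (cong toℕ eq) (Finₚ.toℕ-fromℕ< (v<n x')))) }

-- ⊕ᵛ ρ₁ ρ₂ and ⊖ᵛ ρ₁ ρ₂ are, by definition, concatenations _++_ of the values on the two blocks.
module _ {m₁ m₂} (ρ₁ : Perm m₁) (ρ₂ : Perm m₂) where

  toℕ∘ρ₁-injective : Injective _≡_ _≡_ (toℕ ∘ fun ρ₁)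
  toℕ∘ρ₁-injective = inj ρ₁ ∘ Finₚ.toℕ-injective

  toℕ∘ρ₂-injective : Injective _≡_ _≡_ (toℕ ∘ fun ρ₂)
  toℕ∘ρ₂-injective = inj ρ₂ ∘ Finₚ.toℕ-injective

  _⊕ₚ_ : Perm (m₁ + m₂)
  _⊕ₚ_ = fromValues (⊕ᵛ ρ₁ ρ₂)
    (++⁺ (ℕ._< m₁ + m₂) (λ y → ℕₚ.<-≤-trans (Finₚ.toℕ<n (fun ρ₁ y)) (ℕₚ.m≤m+n m₁ m₂))
                        (λ z → ℕₚ.+-monoʳ-< m₁ (Finₚ.toℕ<n (fun ρ₂ z))))
    (++-injective toℕ∘ρ₁-injective (toℕ∘ρ₂-injective ∘ ℕₚ.+-cancelˡ-≡ m₁ _ _)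
      (λ y z → ℕₚ.<⇒≢ (ℕₚ.<-≤-trans (Finₚ.toℕ<n (fun ρ₁ y)) (ℕₚ.m≤m+n m₁ _))))

  ⊕ₚ-isDirectSum : IsDirectSum _⊕ₚ_ ρ₁ ρ₂
  ⊕ₚ-isDirectSum x = Finₚ.toℕ-fromℕ< _

  _⊖ₚ_ : Perm (m₁ + m₂)
  _⊖ₚ_ = fromValues (⊖ᵛ ρ₁ ρ₂)
    (++⁺ (ℕ._< m₁ + m₂)
      (λ y → subst (m₂ + toℕ (fun ρ₁ y) ℕ.<_) (ℕₚ.+-comm m₂ m₁) (ℕₚ.+-monoʳ-< m₂ (Finₚ.toℕ<n (fun ρ₁ y))))
      (λ z → ℕₚ.<-≤-trans (Finₚ.toℕ<n (fun ρ₂ z)) (ℕₚ.m≤n+m m₂ m₁)))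
    (++-injective (toℕ∘ρ₁-injective ∘ ℕₚ.+-cancelˡ-≡ m₂ _ _) toℕ∘ρ₂-injective
      (λ y z → ℕₚ.>⇒≢ (ℕₚ.<-≤-trans (Finₚ.toℕ<n (fun ρ₂ z)) (ℕₚ.m≤m+n m₂ _))))

  ⊖ₚ-isSkewSum : IsSkewSum _⊖ₚ_ ρ₁ ρ₂
  ⊖ₚ-isSkewSum x = Finₚ.toℕ-fromℕ< _

IsOccurrence : ∀ {k n} → (Fin k → Fin k) → (Fin n → Fin n) → (Fin k → Fin n) → Set
IsOccurrence p s f = StrictlyMonotone f × (∀ l m → p l < p m → s (f l) < s (f m))

∘-isOccurrence : ∀ {j k n} {ρ : Fin j → Fin j} {τ : Fin k → Fin k} {s : Fin n → Fin n}
                 {e : Fin j → Fin k} {f : Fin k → Fin n} →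
                 IsOccurrence ρ τ e → IsOccurrence τ s f → IsOccurrence ρ s (f ∘ e)
∘-isOccurrence (e-mono , e-ord) (f-mono , f-ord) =
  (λ l m → f-mono _ _ ∘ e-mono l m) , (λ l m → f-ord _ _ ∘ e-ord l m)

module _ {m n} {τ : Fin n → Fin n} {e : Fin m → Fin n} {o : ℕ} {ρ : Fin m → Fin m}
         (sh : Shifted τ e o ρ) where

  shifted-isOccurrence : StrictlyMonotone e → IsOccurrence ρ τ e
  shifted-isOccurrence e-mono = e-mono , λ _ _ → shifted-mono-< sh

  shifted-pullback : ∀ {k} {p : Fin k → Fin k} {g : Fin k → Fin n} →
                     (∀ {y y'} → e y < e y' → y < y') → (∀ l → ∃ λ y → e y ≡ g l) →
                     IsOccurrence p τ g → OccursIn p ρ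
  shifted-pullback e-cancel preimage (g-mono , g-ord) =
    g₁ , (λ l m → e-cancel ∘ subst₂ _<_ (sym (e∘g₁ l)) (sym (e∘g₁ m)) ∘ g-mono l m)
       , (λ l m → shifted-cancel-< sh ∘
                  subst₂ (λ x x' → τ x < τ x') (sym (e∘g₁ l)) (sym (e∘g₁ m)) ∘ g-ord l m)
    where
    g₁ = proj₁ ∘ preimage
    e∘g₁ = proj₂ ∘ preimage

module _ {k m₁ m₂} {p : Fin k → Fin k} {τ : Fin (m₁ + m₂) → Fin (m₁ + m₂)}
         {ρ₁ : Fin m₁ → Fin m₁} {ρ₂ : Fin m₂ → Fin m₂} {o₁ o₂ : ℕ}
         (sh₁ : Shifted τ (_↑ˡ m₂) o₁ ρ₁) (sh₂ : Shifted τ (m₁ ↑ʳ_) o₂ ρ₂) where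

  occurs-in-one-block : ∀ {g} → IsOccurrence p τ g →
                        (∀ l l' → isLeft (block m₁ (g l)) ≡ isLeft (block m₁ (g l'))) →
                        OccursIn p ρ₁ ⊎ OccursIn p ρ₂
  occurs-in-one-block {g} g-occ monochrome with Finₚ.any? (λ l → isLeft (block m₁ (g l)) Boolₚ.≟ true)
  ... | yes (l₀ , l₀-left) = inj₁ (shifted-pullback sh₁ ↑ˡ-cancel-<
          (λ l → left-part (block m₁ (g l)) (trans (monochrome l l₀) l₀-left)) g-occ)
  ... | no no-left = inj₂ (shifted-pullback sh₂ ↑ʳ-cancel-<
          (λ l → right-part (block m₁ (g l)) (Boolₚ.¬-not (λ l-left → no-left (l , l-left)))) g-occ)

-- Connectivity of the graph on the positions of p with an edge l – l' whenever
-- l < l' and R (p l) (p l'), phrased as: every colouring constant along edges is constant.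
Connected : ∀ {k} → (Fin k → Fin k → Set) → (Fin k → Fin k) → Set
Connected {k} R p = (A : Fin k → Bool) → (∀ l l' → l < l' → R (p l) (p l') → A l ≡ A l') →
                    ∀ l l' → A l ≡ A l'

constant-via-0 : ∀ {k} {A : Fin (suc k) → Bool} → (∀ l → A l ≡ A zero) → ∀ l l' → A l ≡ A l'
constant-via-0 A≡A₀ l l' = trans (A≡A₀ l) (sym (A≡A₀ l'))

path-0213-constant : ∀ {A : Fin 4 → Bool} → A (# 0) ≡ A (# 2) → A (# 2) ≡ A (# 1) → A (# 1) ≡ A (# 3) →
                     ∀ l l' → A l ≡ A l'
path-0213-constant e₀₂ e₂₁ e₁₃ = constant-via-0 λ where
    zero                   → refl
    (suc zero)             → sym e₀₁
    (suc (suc zero))       → sym e₀₂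
    (suc (suc (suc zero))) → sym (trans e₀₁ e₁₃)
  where e₀₁ = trans e₀₂ e₂₁

path-1032-constant : ∀ {A : Fin 4 → Bool} → A (# 1) ≡ A (# 0) → A (# 0) ≡ A (# 3) → A (# 3) ≡ A (# 2) →
                     ∀ l l' → A l ≡ A l'
path-1032-constant e₁₀ e₀₃ e₃₂ = constant-via-0 λ where
    zero                   → refl
    (suc zero)             → e₁₀
    (suc (suc zero))       → sym (trans e₀₃ e₃₂)
    (suc (suc (suc zero))) → sym e₀₃

2413-inversions-connected : Connected _>_ p2413
2413-inversions-connected A edge = path-0213-constant
  (edge (# 0) (# 2) z<s z<s)
  (sym (edge (# 1) (# 2) (s<s z<s) z<s))
  (edge (# 1) (# 3) (s<s z<s) (s<s (s<s z<s)))

3142-inversions-connected : Connected _>_ p3142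
3142-inversions-connected A edge = path-1032-constant
  (sym (edge (# 0) (# 1) z<s z<s))
  (edge (# 0) (# 3) z<s (s<s z<s))
  (sym (edge (# 2) (# 3) (s<s (s<s z<s)) (s<s z<s)))

2413-noninversions-connected : Connected _<_ p2413
2413-noninversions-connected A edge = path-1032-constant
  (sym (edge (# 0) (# 1) z<s (s<s z<s)))
  (edge (# 0) (# 3) z<s (s<s z<s))
  (sym (edge (# 2) (# 3) (s<s (s<s z<s)) z<s))

3142-noninversions-connected : Connected _<_ p3142
3142-noninversions-connected A edge = path-0213-constant
  (edge (# 0) (# 2) z<s (s<s (s<s z<s)))
  (sym (edge (# 1) (# 2) (s<s z<s) z<s))
  (edge (# 1) (# 3) (s<s z<s) z<s)

InBox : ∀ {n} → (Fin n → Fin n) → Box → Fin n → Set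
InBox s B y = (lo-i B ≤ℤ pos y) × (pos y ≤ℤ hi-i B) × (lo-v B ≤ℤ pos (s y)) × (pos (s y) ≤ℤ hi-v B)

index-part : ∀ {A B C D : Set} → A × B × C × D → A × B
index-part (a , b , _) = a , b

value-part : ∀ {A B C D : Set} → A × B × C × D → C × D
value-part (_ , _ , cd) = cd

box-bounds : ∀ {A B C D : Set} → A × B → C × D → A × B × C × D
box-bounds (a , b) cd = a , b , cd

_⊆_ : Box → Box → Set
B' ⊆ B = (lo-i B ≤ℤ lo-i B') × (hi-i B' ≤ℤ hi-i B) × (lo-v B ≤ℤ lo-v B') × (hi-v B' ≤ℤ hi-v B)

InBox-⊆ : ∀ {n} {s : Fin n → Fin n} {B' B y} → B' ⊆ B → InBox s B' y → InBox s B y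
InBox-⊆ (i≤i' , j'≤j , a≤a' , b'≤b) (i'≤y , y≤j' , a'≤sy , sy≤b') =
  ℤₚ.≤-trans i≤i' i'≤y , ℤₚ.≤-trans y≤j' j'≤j , ℤₚ.≤-trans a≤a' a'≤sy , ℤₚ.≤-trans sy≤b' b'≤b

SplitPoint : Box → ℤ → ℤ → Set
SplitPoint B h c = (lo-i B <ℤ h) × (h ≤ℤ hi-i B) × (lo-v B <ℤ c) × (c ≤ℤ hi-v B)

-- The quadrants of B cut before index h and below value c (indices run west to east,
-- values south to north).
SW NW NE SE : Box → ℤ → ℤ → Box
SW B h c = box (lo-i B) (h - 1ℤ) (lo-v B) (c - 1ℤ)
NW B h c = box (lo-i B) (h - 1ℤ) c (hi-v B)
NE B h c = box h (hi-i B) c (hi-v B)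
SE B h c = box h (hi-i B) (lo-v B) (c - 1ℤ)

SW⊆ : ∀ {B h c} → SplitPoint B h c → SW B h c ⊆ B
SW⊆ (_ , h≤j , _ , c≤b) = ℤₚ.≤-refl , ℤₚ.i≤j⇒i-k≤j 1ℤ h≤j , ℤₚ.≤-refl , ℤₚ.i≤j⇒i-k≤j 1ℤ c≤b

NW⊆ : ∀ {B h c} → SplitPoint B h c → NW B h c ⊆ B
NW⊆ (_ , h≤j , a<c , _) = ℤₚ.≤-refl , ℤₚ.i≤j⇒i-k≤j 1ℤ h≤j , ℤₚ.<⇒≤ a<c , ℤₚ.≤-refl

NE⊆ : ∀ {B h c} → SplitPoint B h c → NE B h c ⊆ B
NE⊆ (i<h , _ , a<c , _) = ℤₚ.<⇒≤ i<h , ℤₚ.≤-refl , ℤₚ.<⇒≤ a<c , ℤₚ.≤-refl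

SE⊆ : ∀ {B h c} → SplitPoint B h c → SE B h c ⊆ B
SE⊆ (i<h , _ , _ , c≤b) = ℤₚ.<⇒≤ i<h , ℤₚ.≤-refl , ℤₚ.≤-refl , ℤₚ.i≤j⇒i-k≤j 1ℤ c≤b

block-occurrence : ∀ {j k n} {ρ : Fin j → Fin j} {τ : Fin k → Fin k} (s : Fin n → Fin n)
                   {e : Fin j → Fin k} {o : ℕ} {f : Fin k → Fin n} {B : Box} →
                   StrictlyMonotone e → Shifted τ e o ρ → IsOccurrence τ s f →
                   (∀ y → InBox s B (f (e y))) → OccursInBox ρ s B
block-occurrence s {e = e} {f = f} e-mono sh f-occ bounds =
  let (mono , ord) = ∘-isOccurrence {s = s} (shifted-isOccurrence sh e-mono) f-occ
  in  f ∘ e , mono , ord , bounds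

module IndexSplit {n m₁ m₂} (f : Fin (suc m₁ + suc m₂) → Fin n) {lo hi : ℤ}
                  (f-mono : StrictlyMonotone f)
                  (bounds : ∀ x → (lo ≤ℤ pos (f x)) × (pos (f x) ≤ℤ hi)) where

  h : ℤ
  h = pos (f (suc m₁ ↑ʳ zero))

  left-bounds : ∀ y → (lo ≤ℤ pos (f (y ↑ˡ suc m₂))) × (pos (f (y ↑ˡ suc m₂)) ≤ℤ h - 1ℤ)
  left-bounds y = proj₁ (bounds _) , pos-<⇒≤-1 (f-mono _ _ (↑ˡ<↑ʳ y zero))

  right-bounds : ∀ z → (h ≤ℤ pos (f (suc m₁ ↑ʳ z))) × (pos (f (suc m₁ ↑ʳ z)) ≤ℤ hi)
  right-bounds z = pos-mono-≤ (<-mono⇒≤-mono (λ eq → eq) f-mono _ _ (↑ʳ-mono-≤ z≤n)) , proj₂ (bounds _)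

  lo<h : lo <ℤ h
  lo<h = ≤-1⇒< (uncurry ℤₚ.≤-trans (left-bounds zero))

  h≤hi : h ≤ℤ hi
  h≤hi = proj₂ (bounds _)

module ValueSplit {k n mLo mHi} (τ : Perm k) (ρHi : Perm (suc mHi))
                  (s : Fin n → Fin n) (f : Fin k → Fin n) {lo hi : ℤ}
                  {eLo : Fin (suc mLo) → Fin k} {ρLo : Fin (suc mLo) → Fin (suc mLo)}
                  {eHi : Fin (suc mHi) → Fin k}
                  (shLo : Shifted (fun τ) eLo 0 ρLo) (shHi : Shifted (fun τ) eHi (suc mLo) (fun ρHi))
                  (f-ord : ∀ x y → fun τ x < fun τ y → s (f x) < s (f y))
                  (bounds : ∀ x → (lo ≤ℤ pos (s (f x))) × (pos (s (f x)) ≤ℤ hi)) where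

  lowest : Fin (suc mHi)
  lowest = proj₁ (Perm-surjective ρHi zero)

  lowest-value : fun ρHi lowest ≡ zero
  lowest-value = proj₂ (Perm-surjective ρHi zero)

  c : ℤ
  c = pos (s (f (eHi lowest)))

  lower-bounds : ∀ u → (lo ≤ℤ pos (s (f (eLo u)))) × (pos (s (f (eLo u))) ≤ℤ c - 1ℤ)
  lower-bounds u = proj₁ (bounds _) , pos-<⇒≤-1 (f-ord _ _ (lower<upper shLo shHi u lowest))

  upper-bounds : ∀ w → (c ≤ℤ pos (s (f (eHi w)))) × (pos (s (f (eHi w))) ≤ℤ hi)
  upper-bounds w = pos-mono-≤ (<-mono⇒≤-mono (inj τ) f-ord _ _ (shifted-mono-≤ shHi lowest≤w)) ,
                   proj₂ (bounds _)
    where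
    lowest≤w : fun ρHi lowest ≤ fun ρHi w
    lowest≤w = subst (_≤ fun ρHi w) (sym lowest-value) z≤n

  lo<c : lo <ℤ c
  lo<c = ≤-1⇒< (uncurry ℤₚ.≤-trans (lower-bounds zero))

  c≤hi : c ≤ℤ hi
  c≤hi = proj₂ (bounds _)

record Splitting {n m₁ m₂} (Q₁ Q₂ : Box → ℤ → ℤ → Box) (s : Fin n → Fin n) (B : Box)
                 (ρ₁ : Perm m₁) (ρ₂ : Perm m₂) : Set where
  field
    h c        : ℤ
    splitPoint : SplitPoint B h c
    occurs₁    : OccursInBox (fun ρ₁) s (Q₁ B h c)
    occurs₂    : OccursInBox (fun ρ₂) s (Q₂ B h c)

glue-blocks : ∀ {n m₁ m₂} (s : Fin n → Fin n) {τ : Fin (m₁ + m₂) → Fin (m₁ + m₂)}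
              {ρ₁ : Fin m₁ → Fin m₁} {ρ₂ : Fin m₂ → Fin m₂} {o₁ o₂ : ℕ} {B B₁ B₂ : Box} →
              Shifted τ (_↑ˡ m₂) o₁ ρ₁ → Shifted τ (m₁ ↑ʳ_) o₂ ρ₂ → B₁ ⊆ B → B₂ ⊆ B →
              hi-i B₁ <ℤ lo-i B₂ →
              (hi-v B₁ <ℤ lo-v B₂ × (∀ y z → τ (y ↑ˡ m₂) < τ (m₁ ↑ʳ z))) ⊎
              (hi-v B₂ <ℤ lo-v B₁ × (∀ y z → τ (m₁ ↑ʳ z) < τ (y ↑ˡ m₂))) →
              OccursInBox ρ₁ s B₁ → OccursInBox ρ₂ s B₂ → OccursInBox τ s B
glue-blocks {m₁ = m₁} {m₂} s {τ} {B = B} sh₁ sh₂ B₁⊆B B₂⊆B index-gap value-order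
            (f₁ , mono₁ , ord₁ , box₁) (f₂ , mono₂ , ord₂ , box₂) =
  f₁ ++ f₂ ,
  ++-pairwise {R = _<_} {S = _<_}
    (λ _ _ → mono₁ _ _ ∘ ↑ˡ-cancel-<) (λ y z _ → left-before-right y z)
    (λ z y R<L → ⊥-elim (ℕₚ.<-asym R<L (↑ˡ<↑ʳ y z))) (λ _ _ → mono₂ _ _ ∘ ↑ʳ-cancel-<) ,
  ++-pairwise {R = λ x x' → τ x < τ x'} {S = λ u v → s u < s v}
    (λ _ _ → ord₁ _ _ ∘ shifted-cancel-< sh₁) left-right
    right-left (λ _ _ → ord₂ _ _ ∘ shifted-cancel-< sh₂) ,
  ++⁺ (InBox s B) (InBox-⊆ {s = s} B₁⊆B ∘ box₁) (InBox-⊆ {s = s} B₂⊆B ∘ box₂)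
  where
  left-before-right : ∀ y z → f₁ y < f₂ z
  left-before-right y z =
    pos-separated (proj₂ (index-part (box₁ y))) index-gap (proj₁ (index-part (box₂ z)))

  left-right : ∀ y z → τ (y ↑ˡ m₂) < τ (m₁ ↑ʳ z) → s (f₁ y) < s (f₂ z)
  left-right y z L<R =
    [ (λ (gap , _) → pos-separated (proj₂ (value-part (box₁ y))) gap (proj₁ (value-part (box₂ z))))
    , (λ (_ , R<L) → ⊥-elim (ℕₚ.<-asym L<R (R<L y z)))
    ]′ value-order

  right-left : ∀ z y → τ (m₁ ↑ʳ z) < τ (y ↑ˡ m₂) → s (f₂ z) < s (f₁ y)
  right-left z y R<L =
    [ (λ (_ , L<R) → ⊥-elim (ℕₚ.<-asym R<L (L<R y z)))
    , (λ (gap , _) → pos-separated (proj₂ (value-part (box₂ z))) gap (proj₁ (value-part (box₁ y))))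
    ]′ value-order

module DirectSum {m₁ m₂} (τ : Perm (m₁ + m₂)) (ρ₁ : Perm m₁) (ρ₂ : Perm m₂)
                 (D : IsDirectSum τ ρ₁ ρ₂) where

  left-block : Shifted (fun τ) (_↑ˡ m₂) 0 (fun ρ₁)
  left-block = shifted λ y → trans (D (y ↑ˡ m₂)) (lookup-++ˡ (toℕ ∘ fun ρ₁) ((m₁ +_) ∘ toℕ ∘ fun ρ₂) y)

  right-block : Shifted (fun τ) (m₁ ↑ʳ_) m₁ (fun ρ₂)
  right-block = shifted λ z → trans (D (m₁ ↑ʳ z)) (lookup-++ʳ (toℕ ∘ fun ρ₁) ((m₁ +_) ∘ toℕ ∘ fun ρ₂) z)

  inversion-within-block : ∀ {x x'} (b : Block m₁ m₂ x) (b' : Block m₁ m₂ x') →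
                           x < x' → fun τ x' < fun τ x → isLeft b ≡ isLeft b'
  inversion-within-block (left y)  (left y')  _ _ = refl
  inversion-within-block (right z) (right z') _ _ = refl
  inversion-within-block (left y)  (right z)  _ τR<τL =
    ⊥-elim (ℕₚ.<-asym τR<τL (lower<upper left-block right-block y z))
  inversion-within-block (right z) (left y) R<L _ = ⊥-elim (ℕₚ.<-asym R<L (↑ˡ<↑ʳ y z))

  avoids : ∀ {k} {p : Fin k → Fin k} → Connected _>_ p →
           ¬ OccursIn p (fun ρ₁) → ¬ OccursIn p (fun ρ₂) → ¬ OccursIn p (fun τ)
  avoids connected ∌₁ ∌₂ (g , g-occ@(g-mono , g-ord)) =
    [ ∌₁ , ∌₂ ]′ (occurs-in-one-block left-block right-block g-occ
      (connected (λ l → isLeft (block m₁ (g l))) λ l l' l<l' pl>pl' →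
        inversion-within-block (block m₁ (g l)) (block m₁ (g l')) (g-mono l l' l<l') (g-ord l' l pl>pl')))

  separable : Separable ρ₁ → Separable ρ₂ → Separable τ
  separable (∌2413₁ , ∌3142₁) (∌2413₂ , ∌3142₂) =
    avoids 2413-inversions-connected ∌2413₁ ∌2413₂ , avoids 3142-inversions-connected ∌3142₁ ∌3142₂

  glue-SW-NE : ∀ {n} (s : Fin n → Fin n) {B h c} → SplitPoint B h c →
               OccursInBox (fun ρ₁) s (SW B h c) → OccursInBox (fun ρ₂) s (NE B h c) →
               OccursInBox (fun τ) s B
  glue-SW-NE s {h = h} {c} sp = glue-blocks s left-block right-block (SW⊆ sp) (NE⊆ sp) (i-1<i h)
    (inj₁ (i-1<i c , lower<upper left-block right-block))

module SkewSum {m₁ m₂} (τ : Perm (m₁ + m₂)) (ρ₁ : Perm m₁) (ρ₂ : Perm m₂)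
               (D : IsSkewSum τ ρ₁ ρ₂) where

  left-block : Shifted (fun τ) (_↑ˡ m₂) m₂ (fun ρ₁)
  left-block = shifted λ y → trans (D (y ↑ˡ m₂)) (lookup-++ˡ ((m₂ +_) ∘ toℕ ∘ fun ρ₁) (toℕ ∘ fun ρ₂) y)

  right-block : Shifted (fun τ) (m₁ ↑ʳ_) 0 (fun ρ₂)
  right-block = shifted λ z → trans (D (m₁ ↑ʳ z)) (lookup-++ʳ ((m₂ +_) ∘ toℕ ∘ fun ρ₁) (toℕ ∘ fun ρ₂) z)

  noninversion-within-block : ∀ {x x'} (b : Block m₁ m₂ x) (b' : Block m₁ m₂ x') →
                              x < x' → fun τ x < fun τ x' → isLeft b ≡ isLeft b'
  noninversion-within-block (left y)  (left y')  _ _ = refl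
  noninversion-within-block (right z) (right z') _ _ = refl
  noninversion-within-block (left y)  (right z)  _ τL<τR =
    ⊥-elim (ℕₚ.<-asym τL<τR (lower<upper right-block left-block z y))
  noninversion-within-block (right z) (left y) R<L _ = ⊥-elim (ℕₚ.<-asym R<L (↑ˡ<↑ʳ y z))

  avoids : ∀ {k} {p : Fin k → Fin k} → Connected _<_ p →
           ¬ OccursIn p (fun ρ₁) → ¬ OccursIn p (fun ρ₂) → ¬ OccursIn p (fun τ)
  avoids connected ∌₁ ∌₂ (g , g-occ@(g-mono , g-ord)) =
    [ ∌₁ , ∌₂ ]′ (occurs-in-one-block left-block right-block g-occ
      (connected (λ l → isLeft (block m₁ (g l))) λ l l' l<l' pl<pl' →
        noninversion-within-block (block m₁ (g l)) (block m₁ (g l')) (g-mono l l' l<l') (g-ord l l' pl<pl')))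

  separable : Separable ρ₁ → Separable ρ₂ → Separable τ
  separable (∌2413₁ , ∌3142₁) (∌2413₂ , ∌3142₂) =
    avoids 2413-noninversions-connected ∌2413₁ ∌2413₂ , avoids 3142-noninversions-connected ∌3142₁ ∌3142₂

  glue-NW-SE : ∀ {n} (s : Fin n → Fin n) {B h c} → SplitPoint B h c →
               OccursInBox (fun ρ₁) s (NW B h c) → OccursInBox (fun ρ₂) s (SE B h c) →
               OccursInBox (fun τ) s B
  glue-NW-SE s {h = h} {c} sp = glue-blocks s left-block right-block (NW⊆ sp) (SE⊆ sp) (i-1<i h)
    (inj₂ (i-1<i c , λ y z → lower<upper right-block left-block z y))

⊕-split : ∀ {n m₁ m₂} (s : Fin n → Fin n) {B}
          {τ : Perm (suc m₁ + suc m₂)} {ρ₁ : Perm (suc m₁)} {ρ₂ : Perm (suc m₂)} →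
          IsDirectSum τ ρ₁ ρ₂ → OccursInBox (fun τ) s B → Splitting SW NE s B ρ₁ ρ₂
⊕-split s {τ = τ} {ρ₁} {ρ₂} D (f , f-mono , f-ord , f-box) = record
  { h = I.h ; c = V.c
  ; splitPoint = I.lo<h , I.h≤hi , V.lo<c , V.c≤hi
  ; occurs₁ = block-occurrence s ↑ˡ-mono-< left-block (f-mono , f-ord)
                λ y → box-bounds (I.left-bounds y) (V.lower-bounds y)
  ; occurs₂ = block-occurrence s ↑ʳ-mono-< right-block (f-mono , f-ord)
                λ z → box-bounds (I.right-bounds z) (V.upper-bounds z)
  }
  where
  open DirectSum τ ρ₁ ρ₂ D
  module I = IndexSplit f f-mono (λ x → index-part (f-box x))
  module V = ValueSplit τ ρ₂ s f left-block right-block f-ord (λ x → value-part (f-box x))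

⊖-split : ∀ {n m₁ m₂} (s : Fin n → Fin n) {B}
          {τ : Perm (suc m₁ + suc m₂)} {ρ₁ : Perm (suc m₁)} {ρ₂ : Perm (suc m₂)} →
          IsSkewSum τ ρ₁ ρ₂ → OccursInBox (fun τ) s B → Splitting NW SE s B ρ₁ ρ₂
⊖-split s {τ = τ} {ρ₁} {ρ₂} D (f , f-mono , f-ord , f-box) = record
  { h = I.h ; c = V.c
  ; splitPoint = I.lo<h , I.h≤hi , V.lo<c , V.c≤hi
  ; occurs₁ = block-occurrence s ↑ˡ-mono-< left-block (f-mono , f-ord)
                λ y → box-bounds (I.left-bounds y) (V.upper-bounds y)
  ; occurs₂ = block-occurrence s ↑ʳ-mono-< right-block (f-mono , f-ord)
                λ z → box-bounds (I.right-bounds z) (V.lower-bounds z)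
  }
  where
  open SkewSum τ ρ₁ ρ₂ D
  module I = IndexSplit f f-mono (λ x → index-part (f-box x))
  module V = ValueSplit τ ρ₁ s f right-block left-block f-ord (λ x → value-part (f-box x))

record SumKind : Set₁ where
  field
    IsSum     : ∀ {m₁ m₂} → Perm (m₁ + m₂) → Perm m₁ → Perm m₂ → Set
    _⊞_       : ∀ {m₁ m₂} → Perm m₁ → Perm m₂ → Perm (m₁ + m₂)
    ⊞-isSum   : ∀ {m₁ m₂} (ρ₁ : Perm m₁) (ρ₂ : Perm m₂) → IsSum (ρ₁ ⊞ ρ₂) ρ₁ ρ₂
    separable : ∀ {m₁ m₂} {τ : Perm (m₁ + m₂)} {ρ₁ : Perm m₁} {ρ₂ : Perm m₂} →
                IsSum τ ρ₁ ρ₂ → Separable ρ₁ → Separable ρ₂ → Separable τ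
    quadrant₁ quadrant₂ : Box → ℤ → ℤ → Box
    split     : ∀ {n m₁ m₂} (s : Fin n → Fin n) {B}
                {τ : Perm (suc m₁ + suc m₂)} {ρ₁ : Perm (suc m₁)} {ρ₂ : Perm (suc m₂)} →
                IsSum τ ρ₁ ρ₂ → OccursInBox (fun τ) s B → Splitting quadrant₁ quadrant₂ s B ρ₁ ρ₂
    glue      : ∀ {n m₁ m₂} (s : Fin n → Fin n) {B h c}
                {τ : Perm (m₁ + m₂)} {ρ₁ : Perm m₁} {ρ₂ : Perm m₂} →
                IsSum τ ρ₁ ρ₂ → SplitPoint B h c → OccursInBox (fun ρ₁) s (quadrant₁ B h c) →
                OccursInBox (fun ρ₂) s (quadrant₂ B h c) → OccursInBox (fun τ) s B

direct : SumKind
direct = record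
  { IsSum = IsDirectSum ; _⊞_ = _⊕ₚ_ ; ⊞-isSum = ⊕ₚ-isDirectSum
  ; separable = λ {_} {_} {τ} {ρ₁} {ρ₂} → DirectSum.separable τ ρ₁ ρ₂
  ; quadrant₁ = SW ; quadrant₂ = NE
  ; split = ⊕-split
  ; glue = λ s {_} {_} {_} {τ} {ρ₁} {ρ₂} D → DirectSum.glue-SW-NE τ ρ₁ ρ₂ D s
  }

skew : SumKind
skew = record
  { IsSum = IsSkewSum ; _⊞_ = _⊖ₚ_ ; ⊞-isSum = ⊖ₚ-isSkewSum
  ; separable = λ {_} {_} {τ} {ρ₁} {ρ₂} → SkewSum.separable τ ρ₁ ρ₂
  ; quadrant₁ = NW ; quadrant₂ = SE
  ; split = ⊖-split
  ; glue = λ s {_} {_} {_} {τ} {ρ₁} {ρ₂} D → SkewSum.glue-NW-SE τ ρ₁ ρ₂ D s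
  }

module _ (S : SumKind) where
  open SumKind S

  maximal-split : ∀ {K} {n : Fin K → ℕ} (σ : (q : Fin K) → Perm (n q)) {B : Fin K → Box}
                  {m₁ m₂} (π : Perm (suc m₁ + suc m₂)) (π₁ : Perm (suc m₁)) (π₂ : Perm (suc m₂)) →
                  MaximalSep π σ B → Separable π₁ → Separable π₂ → IsSum π π₁ π₂ →
                  Σ (Fin K → ℤ) λ h → Σ (Fin K → ℤ) λ c → SplitOK B h c ×
                    MaximalSep π₁ σ (λ q → quadrant₁ (B q) (h q) (c q)) ×
                    MaximalSep π₂ σ (λ q → quadrant₂ (B q) (h q) (c q))
  maximal-split {K} σ {B} {m₁} {m₂} π π₁ π₂ (_ , π-occurs , π-maximal) sep₁ sep₂ π-sum =
    h , c , splitPoint , (sep₁ , occurs₁ , maximal₁) , (sep₂ , occurs₂ , maximal₂)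
    where
    module Parts (q : Fin K) = Splitting (split (fun (σ q)) π-sum (π-occurs q))
    open Parts

    maximal₁ : ∀ m (ρ : Perm m) → Separable ρ → OccursInAll ρ σ (λ q → quadrant₁ (B q) (h q) (c q)) →
               m ℕ.≤ suc m₁
    maximal₁ m ρ sep occurs = ℕₚ.+-cancelʳ-≤ (suc m₂) m (suc m₁)
      (π-maximal (m + suc m₂) (ρ ⊞ π₂) (separable (⊞-isSum ρ π₂) sep sep₂)
        (λ q → glue (fun (σ q)) (⊞-isSum ρ π₂) (splitPoint q) (occurs q) (occurs₂ q)))

    maximal₂ : ∀ m (ρ : Perm m) → Separable ρ → OccursInAll ρ σ (λ q → quadrant₂ (B q) (h q) (c q)) →
               m ℕ.≤ suc m₂
    maximal₂ m ρ sep occurs = ℕₚ.+-cancelˡ-≤ (suc m₁) m (suc m₂)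
      (π-maximal (suc m₁ + m) (π₁ ⊞ ρ) (separable (⊞-isSum π₁ ρ) sep₁ sep)
        (λ q → glue (fun (σ q)) (⊞-isSum π₁ ρ) (splitPoint q) (occurs₁ q) (occurs q)))

lemma2 : (K : ℕ) (n : Fin K → ℕ) (σ : (q : Fin K) → Perm (n q))
    (B : Fin K → Box) (k₁ k₂ : ℕ) (π : Perm (k₁ + k₂))
    (π₁ : Perm k₁) (π₂ : Perm k₂) →
    MaximalSep π σ B → k₁ ≥ 1 → k₂ ≥ 1 → Separable π₁ → Separable π₂ →
    (IsDirectSum π π₁ π₂ →
      Σ (Fin K → ℤ) λ h → Σ (Fin K → ℤ) λ c → SplitOK B h c ×
        MaximalSep π₁ σ (λ q → box (lo-i (B q)) (h q - 1ℤ) (lo-v (B q)) (c q - 1ℤ)) ×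
        MaximalSep π₂ σ (λ q → box (h q) (hi-i (B q)) (c q) (hi-v (B q))))
    × (IsSkewSum π π₁ π₂ →
      Σ (Fin K → ℤ) λ h → Σ (Fin K → ℤ) λ c → SplitOK B h c ×
        MaximalSep π₁ σ (λ q → box (lo-i (B q)) (h q - 1ℤ) (c q) (hi-v (B q))) ×
        MaximalSep π₂ σ (λ q → box (h q) (hi-i (B q)) (lo-v (B q)) (c q - 1ℤ)))
lemma2 K n σ B k₁ k₂ π π₁ π₂ π-maximal (s≤s z≤n) (s≤s z≤n) sep₁ sep₂ =
  maximal-split direct σ π π₁ π₂ π-maximal sep₁ sep₂ , maximal-split skew σ π π₁ π₂ π-maximal sep₁ sep₂
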